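{- Consider the binary decision diagram setting below. Let $\eta=\langle k,l,u\rangle$ be an internal node with label $b_k$, true-child $\eta_1=\langle k+1,l_1,u_1\rangle$ and false-child $\eta_0=\langle k+1,l_0,u_0\rangle$, where $l=\max(l_1+a_k,l_0)$ and $u=\min(u_1+a_k,u_0)$. If the proof configuration contains the defining constraints for $\eta_1$ and $\eta_0$ (with variables $v_{\eta_1},v_{\eta_0}$), and $v_\eta$ is a variable not occurring in the configuration or the objective, then the defining constraints for $\eta$ (with variable $v_\eta$) can be derived in the VeriPB proof system.
   Context: Variables are Boolean, $\bar x=1-x$. Let $\sum_{i=1}^n a_ib_i$ (the objective) have positive integer coefficients $a_i$ and distinct literals $b_i$. A node $\langle k,l,u\rangle$ stands for the Boolean function $\sum_{i=k}^na_ib_i\le[l,u]$; each node $\eta=\langle k,l,u\rangle$ is associated with a variable $v_\eta$, and its defining constraints are $\big((\sum_{i=k}^na_i)-l\big)\bar v_\eta-\sum_{i=k}^na_ib_i\ge -l$ (i.e. $v_\eta\Rightarrow\sum_{i=k}^na_ib_i\le l$) and $(u+1)v_\eta+\sum_{i=k}^na_ib_i\ge u+1$ (i.e. $v_\eta\Leftarrow\sum_{i=k}^na_ib_i\le u$). The VeriPB proof system for a PB optimization instance $(F,O)$ maintains a configuration $\Gamma$ (initially $F$) of PB constraints and allows adding: constraints obtained by cutting planes rules (literal axioms $\ell\ge0$, positive linear combinations, division of normalized constraints by a positive integer with rounding up, saturation); constraints $C$ that are RUP (unit propagation on $\Gamma\wedge\neg C$ yields a contradiction); the constraint $O<O|_\alpha$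 for any assignment $\alpha$ satisfying $\Gamma$ (objective improvement); and, by redundance-based strengthening, any constraint $C$ such that for some substitution $\omega$ (mapping variables to $0$, $1$ or literals) $\Gamma\wedge\neg C\models O\le O|_\omega\wedge(\Gamma\wedge C)|_\omega$. -}

module Defs where

open import Data.Nat as ℕ using (ℕ; zero; suc)
open import Data.Nat.DivMod using (_/_)
open import Data.Integer as ℤ using (ℤ; +_; -[1+_]; 0ℤ; 1ℤ; _+_; _-_; -_; _*_; ∣_∣; _⊔_; _⊓_; _≤ᵇ_)
open import Data.Fin using (Fin; toℕ)
open import Data.Fin.Base using () renaming (zero to fzero; suc to fsuc)
open import Data.Bool using (Bool; true; false; not; if_then_else_)
open import Data.Maybe using (Maybe; just; nothing)
open import Data.Vec using (Vec; lookup; replicate; tabulate; _[_]≔_)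
open import Data.List using (List; []; _∷_; foldr; map; filterᵇ)
open import Data.List.Membership.Propositional using (_∈_)
open import Data.List.Relation.Unary.All using (All)
open import Data.Product using (_×_; _,_; proj₁; proj₂)
open import Relation.Binary.PropositionalEquality using (_≡_)
open import Relation.Nullary using (¬_)

data Lit (N : ℕ) : Set where
  pos : Fin N → Lit N
  neg : Fin N → Lit N

var : ∀ {N} → Lit N → Fin N
var (pos x) = x
var (neg x) = x

Assignment : ℕ → Set
Assignment N = Fin N → Bool

⟦_⟧b : Bool → ℤ
⟦ true ⟧b = 1ℤ
⟦ false ⟧b = 0ℤ

litVal : ∀ {N} → Assignment N → Lit N → Bool
litVal ρ (pos x) = ρ x
litVal ρ (neg x) = not (ρ x)

∑ : ∀ {N} → (Fin N → ℤ) → ℤ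
∑ {zero} f = 0ℤ
∑ {suc N} f = f fzero + ∑ (λ i → f (fsuc i))

-- PB constraints, stored in the canonical form  Σ_x c_x · x ≥ d
-- (literal x̄ is expanded as 1 - x, so every PB constraint over literals
-- has a unique representation of this form).

record Constraint (N : ℕ) : Set where
  constructor _≥ᶜ_
  field
    coef : Vec ℤ N
    deg  : ℤ
open Constraint public

lhs : ∀ {N} → Constraint N → Assignment N → ℤ
lhs C ρ = ∑ (λ x → lookup (coef C) x * ⟦ ρ x ⟧b)

Sat : ∀ {N} → Constraint N → Assignment N → Set
Sat C ρ = deg C ℤ.≤ lhs C ρ

SatAll : ∀ {N} → List (Constraint N) → Assignment N → Set
SatAll Γ ρ = All (λ C → Sat C ρ) Γ

Term : ℕ → Set
Term N = ℤ × Lit N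

linForm : ∀ {N} → List (Term N) → Vec ℤ N × ℤ
linForm [] = replicate _ 0ℤ , 0ℤ
linForm ((c , pos x) ∷ ts) =
  let (v , k) = linForm ts in (v [ x ]≔ (lookup v x + c)) , k
linForm ((c , neg x) ∷ ts) =
  let (v , k) = linForm ts in (v [ x ]≔ (lookup v x - c)) , (k + c)

mkC : ∀ {N} → List (Term N) → ℤ → Constraint N
mkC ts d = proj₁ (linForm ts) ≥ᶜ (d - proj₂ (linForm ts))

negC : ∀ {N} → Constraint N → Constraint N
negC (c ≥ᶜ d) = tabulate (λ x → - lookup c x) ≥ᶜ (1ℤ - d)

-- Normalised form: each variable x contributes the literal x (if c_x ≥ 0)
-- or x̄ (if c_x < 0) with coefficient |c_x|; the degree becomes
-- d + Σ_{c_x<0} |c_x|.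

negPart : ℤ → ℤ
negPart (+ n) = 0ℤ
negPart -[1+ n ] = + suc n

normDeg : ∀ {N} → Constraint N → ℤ
normDeg C = deg C + ∑ (λ x → negPart (lookup (coef C) x))

-- rebuild a constraint from the normalised one after replacing each
-- normalised coefficient |c_x| by f |c_x| (same literal) and the
-- normalised degree by D
rebuild : ∀ {N} → Constraint N → (ℕ → ℕ) → ℤ → Constraint N
rebuild {N} C f D = c' ≥ᶜ (D - ∑ (λ x → negPart (lookup c' x)))
  where
  newc : ℤ → ℤ
  newc (+ n) = + f n
  newc -[1+ n ] = - (+ f (suc n))
  c' : Vec ℤ N
  c' = tabulate (λ x → newc (lookup (coef C) x))

-- division by the positive integer suc k, rounding up
ceilℕ : ℕ → ℕ → ℕ
ceilℕ k n = (n ℕ.+ k) / suc k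

ceilℤ : ℕ → ℤ → ℤ
ceilℤ k (+ n) = + ceilℕ k n
ceilℤ k -[1+ m ] = - (+ (suc m / suc k))

divideC : ∀ {N} → ℕ → Constraint N → Constraint N
divideC k C = rebuild C (ceilℕ k) (ceilℤ k (normDeg C))

saturateC : ∀ {N} → Constraint N → Constraint N
saturateC C = rebuild C (λ a → a ℕ.⊓ ∣ normDeg C ⊔ 0ℤ ∣) (normDeg C)

scaleC : ∀ {N} → ℕ → Constraint N → Constraint N
scaleC m (c ≥ᶜ d) = tabulate (λ x → + m * lookup c x) ≥ᶜ (+ m * d)

addC : ∀ {N} → Constraint N → Constraint N → Constraint N
addC (c ≥ᶜ d) (c' ≥ᶜ d') = tabulate (λ x → lookup c x + lookup c' x) ≥ᶜ (d + d')

unitVec : ∀ {N} → Fin N → ℤ → Vec ℤ N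
unitVec x c = replicate _ 0ℤ [ x ]≔ c

litAxiom : ∀ {N} → Lit N → Constraint N
litAxiom (pos x) = mkC ((1ℤ , pos x) ∷ []) 0ℤ
litAxiom (neg x) = mkC ((1ℤ , neg x) ∷ []) 0ℤ

data CP {N} (Γ : List (Constraint N)) : Constraint N → Set where
  axiom    : ∀ {C} → C ∈ Γ → CP Γ C
  litAx    : ∀ ℓ → CP Γ (litAxiom ℓ)
  add      : ∀ {C D} → CP Γ C → CP Γ D → CP Γ (addC C D)
  scale    : ∀ {C} m → CP Γ C → CP Γ (scaleC (suc m) C)
  divide   : ∀ {C} k → CP Γ C → CP Γ (divideC k C)
  saturate : ∀ {C} → CP Γ C → CP Γ (saturateC C)

PAssign : ℕ → Set
PAssign N = Vec (Maybe Bool) N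

polarity : ℤ → Bool
polarity c = 0ℤ ≤ᵇ c

falsified : Maybe Bool → Bool → Bool
falsified nothing p = false
falsified (just true) p = not p
falsified (just false) p = p

slack : ∀ {N} → PAssign N → Constraint N → ℤ
slack π C =
  ∑ (λ x → let c = lookup (coef C) x in
           if falsified (lookup π x) (polarity c) then 0ℤ else + ∣ c ∣)
  - normDeg C

data UPConflict {N} (Δ : List (Constraint N)) : PAssign N → Set where
  conflict  : ∀ {π} C → C ∈ Δ → slack π C ℤ.< 0ℤ → UPConflict Δ π
  propagate : ∀ {π} C x → C ∈ Δ → lookup π x ≡ nothing →
              slack π C ℤ.< + ∣ lookup (coef C) x ∣ →
              UPConflict Δ (π [ x ]≔ just (polarity (lookup (coef C) x))) →
              UPConflict Δ π

RUP : ∀ {N} → List (Constraint N) → Constraint N → Set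
RUP Γ C = UPConflict (negC C ∷ Γ) (replicate _ nothing)

record Objective (N : ℕ) : Set where
  constructor obj
  field
    ocoef  : Vec ℤ N
    oconst : ℤ
open Objective public

objVal : ∀ {N} → Objective N → Assignment N → ℤ
objVal O ρ = ∑ (λ x → lookup (ocoef O) x * ⟦ ρ x ⟧b) + oconst O

objOf : ∀ {N} → List (Term N) → Objective N
objOf ts = obj (proj₁ (linForm ts)) (proj₂ (linForm ts))

-- the constraint  O < O|_α
improveC : ∀ {N} → Objective N → Assignment N → Constraint N
improveC O α =
  tabulate (λ x → - lookup (ocoef O) x) ≥ᶜ
    (1ℤ - ∑ (λ x → lookup (ocoef O) x * ⟦ α x ⟧b))

data SubstVal (N : ℕ) : Set where
  const : Bool → SubstVal N
  lit   : Lit N → SubstVal N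

Subst : ℕ → Set
Subst N = Fin N → SubstVal N

-- the assignment ρ ∘ ω ; a formula F|_ω holds under ρ iff F holds under ρ ∘ ω
_∘ˢ_ : ∀ {N} → Assignment N → Subst N → Assignment N
(ρ ∘ˢ ω) x with ω x
... | const b = b
... | lit ℓ = litVal ρ ℓ

data Step {N} (O : Objective N) (Γ : List (Constraint N)) : Constraint N → Set where
  cutting : ∀ {C} → CP Γ C → Step O Γ C
  rup     : ∀ {C} → RUP Γ C → Step O Γ C
  objImp  : (α : Assignment N) → SatAll Γ α → Step O Γ (improveC O α)
  redund  : ∀ {C} (ω : Subst N) →
            (∀ ρ → SatAll Γ ρ → ¬ Sat C ρ →
               (objVal O ρ ℤ.≤ objVal O (ρ ∘ˢ ω))
               × SatAll Γ (ρ ∘ˢ ω) × Sat C (ρ ∘ˢ ω)) →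
            Step O Γ C

data Derivation {N} (O : Objective N) : List (Constraint N) → List (Constraint N) → Set where
  done : ∀ {Γ} → Derivation O Γ Γ
  step : ∀ {Γ Γ' C} → Step O Γ C → Derivation O (C ∷ Γ) Γ' → Derivation O Γ Γ'

-- The objective Σ_{i} a_i b_i (indices 0 .. n-1, i.e. i-1 of the paper)
-- and BDD node defining constraints.

tailTerms : ∀ {N n} → (Fin n → ℕ) → (Fin n → Lit N) → ℕ → List (Term N)
tailTerms {n = n} a b k =
  map (λ i → (+ a i , b i)) (filterᵇ (λ i → k ℕ.≤ᵇ toℕ i) (Data.List.allFin n))

tailSum : ∀ {n} → (Fin n → ℕ) → ℕ → ℤ
tailSum {n} a k =
  foldr (λ i s → + a i + s) 0ℤ (filterᵇ (λ i → k ℕ.≤ᵇ toℕ i) (Data.List.allFin n))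

negTerm : ∀ {N} → Term N → Term N
negTerm (c , ℓ) = (- c , ℓ)

-- v ⇒ Σ_{i≥k} a_i b_i ≤ l :  ((Σ_{i≥k} a_i) - l) v̄ - Σ_{i≥k} a_i b_i ≥ -l
defC₁ : ∀ {N n} → (Fin n → ℕ) → (Fin n → Lit N) → ℕ → ℤ → Fin N → Constraint N
defC₁ a b k l v =
  mkC ((tailSum a k - l , neg v) ∷ map negTerm (tailTerms a b k)) (- l)

-- v ⇐ Σ_{i≥k} a_i b_i ≤ u :  (u+1) v + Σ_{i≥k} a_i b_i ≥ u+1
defC₂ : ∀ {N n} → (Fin n → ℕ) → (Fin n → Lit N) → ℕ → ℤ → Fin N → Constraint N
defC₂ a b k u v =
  mkC ((u + 1ℤ , pos v) ∷ tailTerms a b k) (u + 1ℤ)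

NotIn : ∀ {N} → Fin N → Constraint N → Set
NotIn v C = lookup (coef C) v ≡ 0ℤ

-- Both defining constraints of η are added by redundance-based strengthening, the
-- witness being to fix the fresh variable v_η.  Setting v_η := 0 satisfies
-- v_η ⇒ Σ_{i≥k} a_i b_i ≤ l.  Setting v_η := 1 satisfies the converse implication and
-- keeps the first one, because the children's defining constraints give
-- Σ_{i≥k} a_i b_i ≤ u ⇒ Σ_{i≥k} a_i b_i ≤ l by cases on b_k.  Since v_η occurs neither
-- in the configuration nor in the objective, neither substitution changes them.
module Submission where

open import Defs
open import Data.Nat as ℕ using (ℕ; zero; suc; _<_; _≤ᵇ_)
open import Data.Integer as ℤ using (ℤ; +_; _+_; _-_; -_; _*_; 0ℤ; 1ℤ; _≤_; _≤?_; _⊔_; _⊓_)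
open import Data.Integer.Properties
  using ( ≤-refl; ≤-trans; ≤-reflexive; +-monoˡ-≤; +-monoʳ-≤; +-mono-≤; +-comm; +-assoc
        ; +-identityˡ; +-identityʳ; *-identityʳ; *-zeroʳ; neg-distrib-+; neg-distribˡ-*
        ; neg-mono-≤; neg-cancel-≤; i≤j⇒0≤j-i; <⇒≱; ≰⇒>; i<j⇒suc[i]≤j; suc[i]≤j⇒i<j
        ; i≤i⊔j; i≤j⊔i; i⊓j≤i; i⊓j≤j; module ≤-Reasoning)
open import Data.Integer.Tactic.RingSolver using (solve-∀)
open import Data.Fin using (Fin; toℕ; _≟_) renaming (zero to fzero; suc to fsuc)
open import Data.Bool using (Bool; true; false; not; T?)
open import Data.Vec using (Vec; _∷_; lookup; replicate; _[_]≔_)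
open import Data.Vec.Properties using (lookup∘update′; lookup-replicate)
open import Data.List using (List; []; _∷_; map; foldr; filterᵇ; allFin)
open import Data.List.Properties using (map-tabulate; filter-all)
open import Data.List.Membership.Propositional using (_∈_)
open import Data.List.Relation.Unary.All as All using (All; []; _∷_)
open import Data.List.Relation.Unary.All.Properties using (map⁺)
open import Data.List.Relation.Unary.Any using (here; there)
open import Data.Product using (Σ; _×_; _,_; proj₁; proj₂)
open import Function using (_∘_; id)
open import Function.Bundles using (_⇔_; mk⇔; Equivalence)
open import Function.Definitions using (Injective)
open import Function.Properties.Equivalence using () renaming (trans to ⇔-trans)
open import Relation.Nullary using (¬_; yes; no; contradiction)
open import Relation.Nullary.Decidable using (decidable-stable)
open import Relation.Binary.PropositionalEquality
  using (_≡_; _≢_; refl; sym; trans; cong; cong₂; subst; subst₂; module ≡-Reasoning)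

open Equivalence using (to; from)

+-cancelˡ-≤ : ∀ {i j} k → k + i ≤ k + j → i ≤ j
+-cancelˡ-≤ {i} {j} k k+i≤k+j =
  subst₂ _≤_ (cancel k i) (cancel k j) (+-monoʳ-≤ (- k) k+i≤k+j)
  where
  cancel : ∀ x y → - x + (x + y) ≡ y
  cancel = solve-∀

i-k≤j⇔i≤j+k : ∀ {i j k} → i - k ≤ j ⇔ i ≤ j + k
i-k≤j⇔i≤j+k {i} {j} {k} = mk⇔
  (λ i-k≤j → subst (_≤ j + k) (cancel i k) (+-monoˡ-≤ k i-k≤j))
  (λ i≤j+k → subst (i - k ≤_) (uncancel j k) (+-monoˡ-≤ (- k) i≤j+k))
  where
  cancel : ∀ x y → x - y + y ≡ x
  cancel = solve-∀
  uncancel : ∀ x y → x + y - y ≡ x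
  uncancel = solve-∀

i+1≤j⇔i<j : ∀ {i j} → i + 1ℤ ≤ j ⇔ i ℤ.< j
i+1≤j⇔i<j {i} {j} = mk⇔
  (λ i+1≤j → suc[i]≤j⇒i<j (subst (_≤ j) (+-comm i 1ℤ) i+1≤j))
  (λ i<j → subst (_≤ j) (+-comm 1ℤ i) (i<j⇒suc[i]≤j i<j))

0≤+m*⟦β⟧b : ∀ m β → 0ℤ ≤ + m * ⟦ β ⟧b
0≤+m*⟦β⟧b m true  = subst (0ℤ ≤_) (sym (*-identityʳ (+ m))) (ℤ.+≤+ ℕ.z≤n)
0≤+m*⟦β⟧b m false = ≤-reflexive (sym (*-zeroʳ (+ m)))

+m*⟦β⟧b≤+m : ∀ m β → + m * ⟦ β ⟧b ≤ + m
+m*⟦β⟧b≤+m m true  = ≤-reflexive (*-identityʳ (+ m))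
+m*⟦β⟧b≤+m m false = subst (_≤ + m) (sym (*-zeroʳ (+ m))) (ℤ.+≤+ ℕ.z≤n)

⟦not⟧b : ∀ β → ⟦ not β ⟧b ≡ 1ℤ - ⟦ β ⟧b
⟦not⟧b true  = refl
⟦not⟧b false = refl

-- Big-M reification: the coefficient of the bit is exactly large enough to void the
-- inequality when the implication holds vacuously.

reify-bit⇒≤ : ∀ {S E} l β → E ≤ S → (- l ≤ (S - l) * ⟦ not β ⟧b + - E) ⇔ (β ≡ true → E ≤ l)
reify-bit⇒≤ {S} {E} l true _ rewrite *-zeroʳ (S - l) | +-identityˡ (- E) =
  mk⇔ (λ -l≤-E _ → neg-cancel-≤ -l≤-E) (λ E≤l → neg-mono-≤ (E≤l refl))
reify-bit⇒≤ {S} {E} l false E≤S rewrite *-identityʳ (S - l) = mk⇔ (λ _ ()) (λ _ → -l≤S-l-E)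
  where
  open ≤-Reasoning
  swap : ∀ x y z → x - y + - z ≡ x - z + - y
  swap = solve-∀
  -l≤S-l-E : - l ≤ S - l + - E
  -l≤S-l-E = begin
    - l          ≡⟨ +-identityˡ (- l) ⟨
    0ℤ + - l     ≤⟨ +-monoˡ-≤ (- l) (i≤j⇒0≤j-i E≤S) ⟩
    S - E + - l  ≡⟨ swap S E l ⟩
    S - l + - E  ∎

reify-≤⇒bit : ∀ {E} u β → 0ℤ ≤ E → (u + 1ℤ ≤ (u + 1ℤ) * ⟦ β ⟧b + E) ⇔ (E ≤ u → β ≡ true)
reify-≤⇒bit {E} u true 0≤E rewrite *-identityʳ (u + 1ℤ) =
  mk⇔ (λ _ _ → refl) (λ _ → subst (_≤ u + 1ℤ + E) (+-identityʳ (u + 1ℤ)) (+-monoʳ-≤ (u + 1ℤ) 0≤E))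
reify-≤⇒bit {E} u false _ rewrite *-zeroʳ (u + 1ℤ) | +-identityˡ E = mk⇔
  (λ u+1≤E E≤u → contradiction E≤u (<⇒≱ (to i+1≤j⇔i<j u+1≤E)))
  (λ E≤u⇒false → from i+1≤j⇔i<j (≰⇒> (λ E≤u → contradiction (E≤u⇒false E≤u) λ ())))

node-interval : ∀ {E a l u l₁ u₁ l₀ u₀} → l ≡ (l₁ + a) ⊔ l₀ → u ≡ (u₁ + a) ⊓ u₀ →
                (E ≤ u₁ → E ≤ l₁) → (E ≤ u₀ → E ≤ l₀) →
                ∀ β → a * ⟦ β ⟧b + E ≤ u → a * ⟦ β ⟧b + E ≤ l
node-interval {a = a} {l₁ = l₁} {u₁} refl refl child₁ _ true rewrite *-identityʳ a =
  λ a+E≤u →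
    let E≤u₁ = +-cancelˡ-≤ a (≤-trans a+E≤u (≤-trans (i⊓j≤i _ _) (≤-reflexive (+-comm u₁ a))))
    in ≤-trans (+-monoʳ-≤ a (child₁ E≤u₁)) (≤-trans (≤-reflexive (+-comm a l₁)) (i≤i⊔j _ _))
node-interval {E} {a} refl refl _ child₀ false rewrite *-zeroʳ a | +-identityˡ E =
  λ E≤u → ≤-trans (child₀ (≤-trans E≤u (i⊓j≤j _ _))) (i≤j⊔i _ _)

∑-cong : ∀ {N} {f g : Fin N → ℤ} → (∀ x → f x ≡ g x) → ∑ f ≡ ∑ g
∑-cong {zero}  _   = refl
∑-cong {suc N} f≗g = cong₂ _+_ (f≗g fzero) (∑-cong (f≗g ∘ fsuc))

∑-replicate-0 : ∀ {N} (r : Fin N → ℤ) → ∑ (λ x → lookup (replicate N 0ℤ) x * r x) ≡ 0ℤ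
∑-replicate-0 {zero}  r = refl
∑-replicate-0 {suc N} r = trans (+-identityˡ _) (∑-replicate-0 (r ∘ fsuc))

∑-update : ∀ {N} (c : Vec ℤ N) x w (r : Fin N → ℤ) →
           ∑ (λ y → lookup (c [ x ]≔ w) y * r y) ≡ ∑ (λ y → lookup c y * r y) + (w - lookup c x) * r x
∑-update (c₀ ∷ c) fzero w r = shift c₀ w (r fzero) (∑ (λ y → lookup c y * r (fsuc y)))
  where
  shift : ∀ c₀ w r₀ S → w * r₀ + S ≡ c₀ * r₀ + S + (w - c₀) * r₀
  shift = solve-∀
∑-update (c₀ ∷ c) (fsuc x) w r =
  trans (cong (λ s → c₀ * r fzero + s) (∑-update c x w (r ∘ fsuc)))
        (sym (+-assoc (c₀ * r fzero) (∑ (λ y → lookup c y * r (fsuc y))) ((w - lookup c x) * r (fsuc x))))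

evalTerms : ∀ {N} → Assignment N → List (Term N) → ℤ
evalTerms ρ []             = 0ℤ
evalTerms ρ ((c , ℓ) ∷ ts) = c * ⟦ litVal ρ ℓ ⟧b + evalTerms ρ ts

objVal-objOf : ∀ {N} (ρ : Assignment N) ts → objVal (objOf ts) ρ ≡ evalTerms ρ ts
objVal-objOf ρ [] = trans (+-identityʳ _) (∑-replicate-0 (λ x → ⟦ ρ x ⟧b))
objVal-objOf ρ ((c , pos x) ∷ ts) = begin
  ∑ (λ y → lookup (v [ x ]≔ (lookup v x + c)) y * r y) + k  ≡⟨ cong (_+ k) (∑-update v x _ r) ⟩
  ∑ (λ y → lookup v y * r y) + (lookup v x + c - lookup v x) * r x + k
    ≡⟨ regroup (∑ (λ y → lookup v y * r y)) (lookup v x) c (r x) k ⟩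
  c * r x + objVal (objOf ts) ρ                            ≡⟨ cong (λ s → c * r x + s) (objVal-objOf ρ ts) ⟩
  c * r x + evalTerms ρ ts                                 ∎
  where
  open ≡-Reasoning
  v = proj₁ (linForm ts)
  k = proj₂ (linForm ts)
  r = λ y → ⟦ ρ y ⟧b
  regroup : ∀ S v c r k → S + (v + c - v) * r + k ≡ c * r + (S + k)
  regroup = solve-∀
objVal-objOf ρ ((c , neg x) ∷ ts) = begin
  ∑ (λ y → lookup (v [ x ]≔ (lookup v x - c)) y * r y) + (k + c)  ≡⟨ cong (_+ (k + c)) (∑-update v x _ r) ⟩
  ∑ (λ y → lookup v y * r y) + (lookup v x - c - lookup v x) * r x + (k + c)
    ≡⟨ regroup (∑ (λ y → lookup v y * r y)) (lookup v x) c (r x) k ⟩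
  c * (1ℤ - r x) + objVal (objOf ts) ρ
    ≡⟨ cong₂ (λ β e → c * β + e) (sym (⟦not⟧b (ρ x))) (objVal-objOf ρ ts) ⟩
  c * ⟦ not (ρ x) ⟧b + evalTerms ρ ts                            ∎
  where
  open ≡-Reasoning
  v = proj₁ (linForm ts)
  k = proj₂ (linForm ts)
  r = λ y → ⟦ ρ y ⟧b
  regroup : ∀ S v c r k → S + (v - c - v) * r + (k + c) ≡ c * (1ℤ - r) + (S + k)
  regroup = solve-∀

sat-mkC : ∀ {N} (ρ : Assignment N) ts d → Sat (mkC ts d) ρ ⇔ d ≤ evalTerms ρ ts
sat-mkC ρ ts d = subst (λ e → Sat (mkC ts d) ρ ⇔ d ≤ e) (objVal-objOf ρ ts) i-k≤j⇔i≤j+k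

evalTerms-map-negTerm : ∀ {N} (ρ : Assignment N) ts → evalTerms ρ (map negTerm ts) ≡ - evalTerms ρ ts
evalTerms-map-negTerm ρ [] = refl
evalTerms-map-negTerm ρ ((c , ℓ) ∷ ts) =
  trans (cong₂ _+_ (sym (neg-distribˡ-* c β)) (evalTerms-map-negTerm ρ ts))
        (sym (neg-distrib-+ (c * β) (evalTerms ρ ts)))
  where β = ⟦ litVal ρ ℓ ⟧b

_↦_ : ∀ {N} → Fin N → Bool → Subst N
(v ↦ β) x with x ≟ v
... | yes _ = const β
... | no  _ = lit (pos x)

↦-self : ∀ {N} (ρ : Assignment N) v β → (ρ ∘ˢ (v ↦ β)) v ≡ β
↦-self ρ v β with v ≟ v
... | yes _   = refl
... | no  v≢v = contradiction refl v≢v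

∑-↦ : ∀ {N} (c : Vec ℤ N) {v} β ρ → lookup c v ≡ 0ℤ →
      ∑ (λ x → lookup c x * ⟦ (ρ ∘ˢ (v ↦ β)) x ⟧b) ≡ ∑ (λ x → lookup c x * ⟦ ρ x ⟧b)
∑-↦ c {v} β ρ cᵥ≡0 = ∑-cong pointwise
  where
  pointwise : ∀ x → lookup c x * ⟦ (ρ ∘ˢ (v ↦ β)) x ⟧b ≡ lookup c x * ⟦ ρ x ⟧b
  pointwise x with x ≟ v
  ... | yes refl rewrite cᵥ≡0 = refl
  ... | no  _    = refl

satAll-↦ : ∀ {N} {Γ : List (Constraint N)} {v ρ} β → All (NotIn v) Γ → SatAll Γ ρ → SatAll Γ (ρ ∘ˢ (v ↦ β))
satAll-↦ β [] [] = []
satAll-↦ {Γ = C ∷ _} {ρ = ρ} β (v∉C ∷ v∉Γ) (ρ⊨C ∷ ρ⊨Γ) =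
  subst (deg C ≤_) (sym (∑-↦ (coef C) β ρ v∉C)) ρ⊨C ∷ satAll-↦ β v∉Γ ρ⊨Γ

Avoids : ∀ {N} → Fin N → List (Term N) → Set
Avoids v = All (λ t → var (proj₂ t) ≢ v)

linForm-avoids : ∀ {N} {v : Fin N} {ts} → Avoids v ts → lookup (proj₁ (linForm ts)) v ≡ 0ℤ
linForm-avoids {v = v} {[]} [] = lookup-replicate v 0ℤ
linForm-avoids {ts = (_ , pos x) ∷ ts} (x≢v ∷ avoids) =
  trans (lookup∘update′ (x≢v ∘ sym) (proj₁ (linForm ts)) _) (linForm-avoids avoids)
linForm-avoids {ts = (_ , neg x) ∷ ts} (x≢v ∷ avoids) =
  trans (lookup∘update′ (x≢v ∘ sym) (proj₁ (linForm ts)) _) (linForm-avoids avoids)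

objVal-↦ : ∀ {N} {v : Fin N} {ts} β ρ → Avoids v ts → objVal (objOf ts) (ρ ∘ˢ (v ↦ β)) ≡ objVal (objOf ts) ρ
objVal-↦ {ts = ts} β ρ avoids =
  cong (_+ oconst (objOf ts)) (∑-↦ (ocoef (objOf ts)) β ρ (linForm-avoids avoids))

evalTerms-↦ : ∀ {N} {v : Fin N} {ts} β ρ → Avoids v ts → evalTerms (ρ ∘ˢ (v ↦ β)) ts ≡ evalTerms ρ ts
evalTerms-↦ {ts = ts} β ρ avoids = begin
  evalTerms (ρ ∘ˢ (_ ↦ β)) ts       ≡⟨ objVal-objOf _ ts ⟨
  objVal (objOf ts) (ρ ∘ˢ (_ ↦ β))  ≡⟨ objVal-↦ β ρ avoids ⟩
  objVal (objOf ts) ρ               ≡⟨ objVal-objOf ρ ts ⟩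
  evalTerms ρ ts                    ∎
  where open ≡-Reasoning

redundance-fresh : ∀ {N} {Γ : List (Constraint N)} {C ts v} β → Avoids v ts →
                   (∀ ρ → SatAll Γ ρ → ¬ Sat C ρ → SatAll (C ∷ Γ) (ρ ∘ˢ (v ↦ β))) →
                   Step (objOf ts) Γ C
redundance-fresh β avoids repair = redund (_ ↦ β) λ ρ ρ⊨Γ ρ⊭C →
  let σ⊨C , σ⊨Γ = All.uncons (repair ρ ρ⊨Γ ρ⊭C)
  in ≤-reflexive (sym (objVal-↦ β ρ avoids)) , σ⊨Γ , σ⊨C

atLeast : ∀ {n} → ℕ → Fin n → Bool
atLeast K i = K ≤ᵇ toℕ i

suc≤ᵇsuc : ∀ m n → (suc m ≤ᵇ suc n) ≡ (m ≤ᵇ n)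
suc≤ᵇsuc zero    n = refl
suc≤ᵇsuc (suc m) n = refl

filter-atLeast-0 : ∀ {n} (is : List (Fin n)) → filterᵇ (atLeast 0) is ≡ is
filter-atLeast-0 is = filter-all (T? ∘ atLeast 0) (All.universal _ is)

filter-atLeast-map-suc : ∀ {n} K (is : List (Fin n)) →
                         filterᵇ (atLeast (suc K)) (map fsuc is) ≡ map fsuc (filterᵇ (atLeast K) is)
filter-atLeast-map-suc K [] = refl
filter-atLeast-map-suc K (i ∷ is) rewrite suc≤ᵇsuc K (toℕ i) with K ≤ᵇ toℕ i
... | true  = cong (fsuc i ∷_) (filter-atLeast-map-suc K is)
... | false = filter-atLeast-map-suc K is

allFin-suc : ∀ n → allFin (suc n) ≡ fzero ∷ map fsuc (allFin n)
allFin-suc n = cong (fzero ∷_) (sym (map-tabulate id fsuc))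

filter-atLeast-toℕ : ∀ {n} (k : Fin n) →
                     filterᵇ (atLeast (toℕ k)) (allFin n) ≡ k ∷ filterᵇ (atLeast (suc (toℕ k))) (allFin n)
filter-atLeast-toℕ {suc n} fzero = begin
  filterᵇ (atLeast 0) (allFin (suc n))                ≡⟨ filter-atLeast-0 _ ⟩
  allFin (suc n)                                      ≡⟨ allFin-suc n ⟩
  fzero ∷ map fsuc (allFin n)                         ≡⟨ cong (λ is → fzero ∷ map fsuc is) (filter-atLeast-0 _) ⟨
  fzero ∷ map fsuc (filterᵇ (atLeast 0) (allFin n))   ≡⟨ cong (fzero ∷_) (filter-atLeast-map-suc 0 (allFin n)) ⟨
  fzero ∷ filterᵇ (atLeast 1) (map fsuc (allFin n))   ≡⟨ cong (λ is → fzero ∷ filterᵇ (atLeast 1) is) (allFin-suc n) ⟨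
  fzero ∷ filterᵇ (atLeast 1) (allFin (suc n))        ∎
  where open ≡-Reasoning
filter-atLeast-toℕ {suc n} (fsuc k) = begin
  filterᵇ (atLeast (suc K)) (allFin (suc n))             ≡⟨ cong (filterᵇ (atLeast (suc K))) (allFin-suc n) ⟩
  filterᵇ (atLeast (suc K)) (map fsuc (allFin n))        ≡⟨ filter-atLeast-map-suc K (allFin n) ⟩
  map fsuc (filterᵇ (atLeast K) (allFin n))              ≡⟨ cong (map fsuc) (filter-atLeast-toℕ k) ⟩
  fsuc k ∷ map fsuc (filterᵇ (atLeast (suc K)) (allFin n))
    ≡⟨ cong (fsuc k ∷_) (filter-atLeast-map-suc (suc K) (allFin n)) ⟨
  fsuc k ∷ filterᵇ (atLeast (suc (suc K))) (map fsuc (allFin n))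
    ≡⟨ cong (λ is → fsuc k ∷ filterᵇ (atLeast (suc (suc K))) is) (allFin-suc n) ⟨
  fsuc k ∷ filterᵇ (atLeast (suc (suc K))) (allFin (suc n)) ∎
  where
  open ≡-Reasoning
  K = toℕ k

module Tails {N n : ℕ} (a : Fin n → ℕ) (b : Fin n → Lit N) where

  tailIndices : ℕ → List (Fin n)
  tailIndices K = filterᵇ (atLeast K) (allFin n)

  tailValue : Assignment N → ℕ → ℤ
  tailValue ρ K = evalTerms ρ (tailTerms a b K)

  tailValue-split : ∀ ρ k →
                    tailValue ρ (toℕ k) ≡ + a k * ⟦ litVal ρ (b k) ⟧b + tailValue ρ (suc (toℕ k))
  tailValue-split ρ k = cong (evalTerms ρ ∘ map (λ i → (+ a i , b i))) (filter-atLeast-toℕ k)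

  0≤evalTerms-indexed : ∀ ρ is → 0ℤ ≤ evalTerms ρ (map (λ i → (+ a i , b i)) is)
  0≤evalTerms-indexed ρ []       = ≤-refl
  0≤evalTerms-indexed ρ (i ∷ is) = +-mono-≤ (0≤+m*⟦β⟧b (a i) _) (0≤evalTerms-indexed ρ is)

  evalTerms-indexed≤weight : ∀ ρ is →
                             evalTerms ρ (map (λ i → (+ a i , b i)) is) ≤ foldr (λ i s → + a i + s) 0ℤ is
  evalTerms-indexed≤weight ρ []       = ≤-refl
  evalTerms-indexed≤weight ρ (i ∷ is) = +-mono-≤ (+m*⟦β⟧b≤+m (a i) _) (evalTerms-indexed≤weight ρ is)

  tailTerms-avoids : ∀ {v} → (∀ i → var (b i) ≢ v) → ∀ K → Avoids v (tailTerms a b K)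
  tailTerms-avoids v∉b K = map⁺ (All.universal v∉b _)

  sat-defC₁ : ∀ ρ K l v → Sat (defC₁ a b K l v) ρ ⇔ (ρ v ≡ true → tailValue ρ K ≤ l)
  sat-defC₁ ρ K l v =
    ⇔-trans (sat-mkC ρ ((tailSum a K - l , neg v) ∷ map negTerm (tailTerms a b K)) (- l))
    (subst (λ e → (- l ≤ (tailSum a K - l) * ⟦ not (ρ v) ⟧b + e) ⇔ (ρ v ≡ true → tailValue ρ K ≤ l))
           (sym (evalTerms-map-negTerm ρ (tailTerms a b K)))
           (reify-bit⇒≤ l (ρ v) (evalTerms-indexed≤weight ρ (tailIndices K))))

  sat-defC₂ : ∀ ρ K u v → Sat (defC₂ a b K u v) ρ ⇔ (tailValue ρ K ≤ u → ρ v ≡ true)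
  sat-defC₂ ρ K u v = ⇔-trans (sat-mkC ρ ((u + 1ℤ , pos v) ∷ tailTerms a b K) (u + 1ℤ))
    (reify-≤⇒bit u (ρ v) (0≤evalTerms-indexed ρ (tailIndices K)))

  defining-interval : ∀ ρ K l u v → Sat (defC₁ a b K l v) ρ → Sat (defC₂ a b K u v) ρ →
                      tailValue ρ K ≤ u → tailValue ρ K ≤ l
  defining-interval ρ K l u v ρ⊨C₁ ρ⊨C₂ =
    to (sat-defC₁ ρ K l v) ρ⊨C₁ ∘ to (sat-defC₂ ρ K u v) ρ⊨C₂

proposition6 :
    (N n : ℕ) (a : Fin n → ℕ) (b : Fin n → Lit N) →
    (∀ i → 0 < a i) → Injective _≡_ _≡_ b →
    (k : Fin n) (l u l₁ u₁ l₀ u₀ : ℤ) →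
    l ≡ (l₁ + + a k) ⊔ l₀ → u ≡ (u₁ + + a k) ⊓ u₀ →
    (v₁ v₀ v : Fin N) (Γ : List (Constraint N)) →
    defC₁ a b (ℕ.suc (toℕ k)) l₁ v₁ ∈ Γ → defC₂ a b (ℕ.suc (toℕ k)) u₁ v₁ ∈ Γ →
    defC₁ a b (ℕ.suc (toℕ k)) l₀ v₀ ∈ Γ → defC₂ a b (ℕ.suc (toℕ k)) u₀ v₀ ∈ Γ →
    All (NotIn v) Γ → (∀ i → var (b i) ≢ v) →
    Σ (List (Constraint N)) (λ Γ' →
      Derivation (objOf (tailTerms a b 0)) Γ Γ'
      × defC₁ a b (toℕ k) l v ∈ Γ' × defC₂ a b (toℕ k) u v ∈ Γ')
proposition6 N n a b _ _ k l u l₁ u₁ l₀ u₀ l≡ u≡ v₁ v₀ v Γ η₁ˡ η₁ᵘ η₀ˡ η₀ᵘ v∉Γ v∉b =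
  Cᵘ ∷ Cˡ ∷ Γ ,
  step (redundance-fresh false (tailTerms-avoids v∉b 0) introduce-Cˡ)
    (step (redundance-fresh true (tailTerms-avoids v∉b 0) introduce-Cᵘ) done) ,
  there (here refl) , here refl
  where
  open Tails a b
  K  = toℕ k
  Cˡ = defC₁ a b K l v
  Cᵘ = defC₂ a b K u v

  ≤u⇒≤l : ∀ ρ → SatAll Γ ρ → tailValue ρ K ≤ u → tailValue ρ K ≤ l
  ≤u⇒≤l ρ ⊨Γ rewrite tailValue-split ρ k =
    node-interval l≡ u≡
      (defining-interval ρ (suc K) l₁ u₁ v₁ (All.lookup ⊨Γ η₁ˡ) (All.lookup ⊨Γ η₁ᵘ))
      (defining-interval ρ (suc K) l₀ u₀ v₀ (All.lookup ⊨Γ η₀ˡ) (All.lookup ⊨Γ η₀ᵘ))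
      (litVal ρ (b k))

  introduce-Cˡ : ∀ ρ → SatAll Γ ρ → ¬ Sat Cˡ ρ → SatAll (Cˡ ∷ Γ) (ρ ∘ˢ (v ↦ false))
  introduce-Cˡ ρ ⊨Γ _ =
    from (sat-defC₁ _ K l v) (λ v↦true → contradiction (trans (sym (↦-self ρ v false)) v↦true) λ ())
    ∷ satAll-↦ false v∉Γ ⊨Γ

  introduce-Cᵘ : ∀ ρ → SatAll (Cˡ ∷ Γ) ρ → ¬ Sat Cᵘ ρ → SatAll (Cᵘ ∷ Cˡ ∷ Γ) (ρ ∘ˢ (v ↦ true))
  introduce-Cᵘ ρ (_ ∷ ⊨Γ) ⊭Cᵘ =
    from (sat-defC₂ _ K u v) (λ _ → ↦-self ρ v true)
    ∷ from (sat-defC₁ _ K l v)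
        (λ _ → subst (_≤ l) (sym (evalTerms-↦ true ρ (tailTerms-avoids v∉b K))) (≤u⇒≤l ρ ⊨Γ ≤u))
    ∷ satAll-↦ true v∉Γ ⊨Γ
    where
    ≤u : tailValue ρ K ≤ u
    ≤u = decidable-stable (tailValue ρ K ≤? u)
           (λ ≰u → ⊭Cᵘ (from (sat-defC₂ ρ K u v) (λ ≤u → contradiction ≤u ≰u)))
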